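{- For $n\ge 2$ and $1\le k\le n-1$, the enhanced hypercube satisfies $\det(Q_{n,k})=\max\{\det(Q_{k-1}),\det(FQ_{n-k+1})\}$.
   Context: $Q_m$ is the $m$-dimensional hypercube (vertex set $\mathbb{Z}_2^m$, adjacency iff differing in exactly one position; $Q_0$ is a single vertex). $FQ_m$ is the folded hypercube: vertex set $\mathbb{Z}_2^m$, adjacency iff differing in exactly one position or in all $m$ positions. The enhanced hypercube $Q_{n,k}$ ($1\le k\le n-1$) is obtained from $Q_n$ by adding an edge between $x=x_1\dots x_n$ and $y=y_1\dots y_n$ whenever $y_i=x_i$ for $1\le i\le k-1$ and $y_i\ne x_i$ for $k\le i\le n$. A determining set of a graph is a vertex set such that the only automorphism fixing each of its vertices is the identity; $\det$ is the minimum size of a determining set. -}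

module Defs where

open import Data.Nat using (ℕ; zero; suc; _∸_; _<_; _≤_)
open import Data.Bool using (Bool)
open import Data.Fin using (Fin; toℕ)
open import Data.Vec using (Vec; []; _∷_; lookup)
open import Data.List using (List; length)
open import Data.List.Membership.Propositional using (_∈_)
open import Data.List.Relation.Unary.Unique.Propositional using (Unique)
open import Data.Product using (Σ; _×_; _,_)
open import Data.Sum using (_⊎_)
open import Relation.Binary.PropositionalEquality using (_≡_; _≢_)
open import Relation.Nullary using (Dec; yes; no)
open import Data.Bool.Properties using () renaming (_≟_ to _≟ᵇ_)
open import Function.Bundles using (_⇔_)

record Graph : Set₁ where
  field
    V   : Set
    Adj : V → V → Set
open Graph public

hamming : ∀ {m} → Vec Bool m → Vec Bool m → ℕ
hamming [] [] = 0
hamming (a ∷ x) (b ∷ y) with a ≟ᵇ b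
... | yes _ = hamming x y
... | no  _ = suc (hamming x y)

Q : ℕ → Graph
Q m = record { V = Vec Bool m ; Adj = λ x y → hamming x y ≡ 1 }

FQ : ℕ → Graph
FQ m = record { V = Vec Bool m ; Adj = λ x y → hamming x y ≡ 1 ⊎ hamming x y ≡ m }

-- Enhanced hypercube Q_{n,k}: hypercube edges, plus edges between x and y with
-- y_i = x_i for 1 ≤ i ≤ k-1 and y_i ≠ x_i for k ≤ i ≤ n (1-based positions;
-- position i (1-based) is Fin index i-1, so "i ≤ k-1" is "toℕ j < k ∸ 1").
Qe : (n k : ℕ) → Graph
Qe n k = record
  { V = Vec Bool n
  ; Adj = λ x y → hamming x y ≡ 1
                ⊎ ((j : Fin n) → (toℕ j < k ∸ 1 → lookup x j ≡ lookup y j)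
                               × (k ∸ 1 ≤ toℕ j → lookup x j ≢ lookup y j))
  }

record Automorphism (G : Graph) : Set where
  field
    to       : V G → V G
    from     : V G → V G
    to-from  : ∀ v → to (from v) ≡ v
    from-to  : ∀ v → from (to v) ≡ v
    adj      : ∀ u v → Adj G u v ⇔ Adj G (to u) (to v)
open Automorphism public

IsDetermining : (G : Graph) → List (V G) → Set
IsDetermining G S = (f : Automorphism G) → (∀ v → v ∈ S → to f v ≡ v) → ∀ v → to f v ≡ v

Det : Graph → ℕ → Set
Det G d = (Σ (List (V G)) λ S → Unique S × IsDetermining G S × length S ≡ d)
        × ((S : List (V G)) → Unique S → IsDetermining G S → d ≤ length S)

{-# OPTIONS --safe #-}
-- Reordering coordinates, Q_{n,k} is the Cartesian product Q_p □ FQ_m with p = k - 1 and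
-- m = n - k + 1 ≥ 2: its extra edges are the antipodal edges of FQ_m.  Every automorphism
-- of Q_p □ FQ_m maps Q_p-edges to Q_p-edges.  Otherwise, for some coordinate i of Q_p, the
-- edges sent to the i-th coordinate class would form a matching cut containing a vertical
-- edge.  A matching cut containing an edge contains its whole parallel class, hence equals
-- it; but no parallel class of FQ_m is a cut, because FQ_m has a closed walk crossing any
-- given class exactly once.  So every automorphism is a product α × β.  Pairing up determining
-- sets of the two factors gives a determining set of the product of size
-- max (det Q_p) (det FQ_m); conversely both projections of a determining set of the
-- product are determining for the factors.
module Submission where

open import Defs
open import Data.Bool using (Bool; true; false; not; _xor_)
open import Data.Bool.Properties
  using (not-involutive; not-¬; ¬-not; not-distribʳ-xor) renaming (_≟_ to _≟ᵇ_)
open import Data.Empty using (⊥; ⊥-elim)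
open import Data.Fin using (Fin; zero; suc; toℕ)
open import Data.Fin.Properties using () renaming (_≟_ to _≟ᶠ_)
open import Data.List using (List; []; _∷_; length; map; alignWith; deduplicate)
open import Data.List.Membership.Propositional using (_∈_)
open import Data.List.Membership.Propositional.Properties using (∈-map⁺; ∈-deduplicate⁺)
open import Data.List.Properties using (length-map; length-alignWith; length-deduplicate)
open import Data.List.Relation.Unary.Any using (here; there)
open import Data.List.Relation.Unary.Unique.DecPropositional.Properties using (deduplicate-!)
open import Data.List.Relation.Unary.Unique.Propositional.Properties using (map⁺)
open import Data.Nat using (ℕ; zero; suc; pred; _≤_; _<_; _∸_; _⊔_; _+_; z≤n; s≤s)
open import Data.Nat.Properties
  using (0≢1+n; 1+n≰n; m≤n⇒m≤1+n; ≤-trans; ≤-antisym; ⊔-lub; m≤m+n; +-suc; +-comm;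
         +-∸-assoc; m+n∸m≡n; m≤n⇒∃[o]m+o≡n)
open import Data.Product using (Σ; ∃; _×_; _,_; proj₁; proj₂; map₁; map₂)
import Data.Product as Product
open import Data.Product.Properties using () renaming (≡-dec to ≡-dec-×)
open import Data.Sum using (_⊎_; inj₁; inj₂)
open import Data.These using (foldWithDefaults)
open import Data.Vec as Vec using (Vec; []; _∷_; lookup; _++_; _[_]%=_; take; drop)
open import Data.Vec.Properties
  using (lookup∘updateAt; lookup∘updateAt′; updateAt-updateAt; updateAt-cong; updateAt-id;
         updateAt-commutes; map-updateAt; lookup-map; map-∘; map-cong; map-id;
         take++drop≡id; ++-injective)
  renaming (≡-dec to ≡-dec-Vec)
open import Function using (_∘_)
open import Function.Bundles using (_⇔_; mk⇔; Equivalence)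
open import Function.Construct.Composition using (_⇔-∘_)
open import Function.Construct.Identity using (⇔-id)
open import Function.Construct.Symmetry using (⇔-sym)
open import Relation.Binary.Definitions using (DecidableEquality; Irreflexive)
open import Relation.Binary.PropositionalEquality
  using (_≡_; _≢_; refl; sym; trans; cong; cong₂; subst; subst₂; ≢-sym; module ≡-Reasoning)
open import Relation.Nullary using (yes; no)

module ⇔ = Equivalence

private variable
  n p : ℕ
  G H K : Graph

infix 4 _≅_
record _≅_ (G H : Graph) : Set where
  field
    to      : V G → V H
    from    : V H → V G
    to-from : ∀ v → to (from v) ≡ v
    from-to : ∀ v → from (to v) ≡ v
    adj     : ∀ u v → Adj G u v ⇔ Adj H (to u) (to v)
open _≅_ public

≅-sym : G ≅ H → H ≅ G
≅-sym {G} {H} I = record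
  { to = from I ; from = to I ; to-from = from-to I ; from-to = to-from I
  ; adj = λ u v → ⇔-sym (subst₂ (λ u′ v′ → Adj G (from I u) (from I v) ⇔ Adj H u′ v′)
                                (to-from I u) (to-from I v) (adj I (from I u) (from I v)))
  }

≅-trans : G ≅ H → H ≅ K → G ≅ K
≅-trans I J = record
  { to = to J ∘ to I ; from = from I ∘ from J
  ; to-from = λ v → trans (cong (to J) (to-from I (from J v))) (to-from J v)
  ; from-to = λ v → trans (cong (from I) (from-to J (to I v))) (from-to I v)
  ; adj = λ u v → adj J (to I u) (to I v) ⇔-∘ adj I u v
  }

≅-to-injective : (I : G ≅ H) → ∀ {u v} → to I u ≡ to I v → u ≡ v
≅-to-injective I {u} {v} eq = trans (sym (from-to I u)) (trans (cong (from I) eq) (from-to I v))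

aut⇒≅ : Automorphism G → G ≅ G
aut⇒≅ g = record { to = to g ; from = from g ; to-from = to-from g ; from-to = from-to g ; adj = adj g }

≅⇒aut : G ≅ G → Automorphism G
≅⇒aut I = record { to = to I ; from = from I ; to-from = to-from I ; from-to = from-to I ; adj = adj I }

id-aut : Automorphism G
id-aut {G} = record
  { to = λ v → v ; from = λ v → v ; to-from = λ _ → refl ; from-to = λ _ → refl
  ; adj = λ u v → ⇔-id (Adj G u v)
  }

_⁻¹ : Automorphism G → Automorphism G
g ⁻¹ = ≅⇒aut (≅-sym (aut⇒≅ g))

conjugate : G ≅ H → Automorphism H → Automorphism G
conjugate I h = ≅⇒aut (≅-trans I (≅-trans (aut⇒≅ h) (≅-sym I)))

IsDetermining-resp-≅ : (I : G ≅ H) {S : List (V G)} →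
                       IsDetermining G S → IsDetermining H (map (to I) S)
IsDetermining-resp-≅ I {S} detS h fixes a = begin
  to h a                                  ≡⟨ cong (to h) (sym (to-from I a)) ⟩
  to h (to I (from I a))                  ≡⟨ sym (to-from I _) ⟩
  to I (from I (to h (to I (from I a))))  ≡⟨ cong (to I) (detS (conjugate I h) fixesS (from I a)) ⟩
  to I (from I a)                         ≡⟨ to-from I a ⟩
  a                                       ∎
  where
  open ≡-Reasoning
  fixesS : ∀ v → v ∈ S → from I (to h (to I v)) ≡ v
  fixesS v v∈S = trans (cong (from I) (fixes (to I v) (∈-map⁺ (to I) v∈S))) (from-to I v)

Det-resp-≅ : ∀ {d} → G ≅ H → Det G d → Det H d
Det-resp-≅ {d = d} I ((S , S! , detS , |S|) , minimal) =
  ( map (to I) S , map⁺ (≅-to-injective I) S! , IsDetermining-resp-≅ I detS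
  , trans (length-map (to I) S) |S|) ,
  λ T T! detT → subst (d ≤_) (length-map (from I) T)
    (minimal (map (from I) T) (map⁺ (≅-to-injective (≅-sym I)) T!) (IsDetermining-resp-≅ (≅-sym I) detT))

det≤length : ∀ {d S} → DecidableEquality (V G) → Det G d → IsDetermining G S → d ≤ length S
det≤length {S = S} _≟_ (_ , minimal) detS =
  ≤-trans (minimal (deduplicate _≟_ S) (deduplicate-! _≟_ S) detDedup) (length-deduplicate _≟_ S)
  where
  detDedup : IsDetermining _ (deduplicate _≟_ S)
  detDedup g fixes = detS g (λ v v∈S → fixes v (∈-deduplicate⁺ _≟_ v∈S))

-- Cartesian products

infixr 6 _□_ _⊠_
_□_ : Graph → Graph → Graph
G □ H = record
  { V = V G × V H
  ; Adj = λ u v → (Adj G (proj₁ u) (proj₁ v) × proj₂ u ≡ proj₂ v)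
                ⊎ (proj₁ u ≡ proj₁ v × Adj H (proj₂ u) (proj₂ v))
  }

_⊠_ : Automorphism G → Automorphism H → Automorphism (G □ H)
_⊠_ {G} {H} α β = record
  { to = αβ
  ; from = Product.map (from α) (from β)
  ; to-from = λ (x , y) → cong₂ _,_ (to-from α x) (to-from β y)
  ; from-to = λ (x , y) → cong₂ _,_ (from-to α x) (from-to β y)
  ; adj = λ u v → mk⇔ preserve reflect
  }
  where
  αβ : V (G □ H) → V (G □ H)
  αβ = Product.map (to α) (to β)
  preserve : ∀ {u v} → Adj (G □ H) u v → Adj (G □ H) (αβ u) (αβ v)
  preserve (inj₁ (x∼x′ , refl)) = inj₁ (⇔.to (adj α _ _) x∼x′ , refl)
  preserve (inj₂ (refl , y∼y′)) = inj₂ (refl , ⇔.to (adj β _ _) y∼y′)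
  reflect : ∀ {u v} → Adj (G □ H) (αβ u) (αβ v) → Adj (G □ H) u v
  reflect (inj₁ (x∼x′ , βy≡βy′)) =
    inj₁ (⇔.from (adj α _ _) x∼x′ , ≅-to-injective (aut⇒≅ β) βy≡βy′)
  reflect (inj₂ (αx≡αx′ , y∼y′)) =
    inj₂ (≅-to-injective (aut⇒≅ α) αx≡αx′ , ⇔.from (adj β _ _) y∼y′)

Splits : Automorphism (G □ H) → Set
Splits {G} {H} g = Σ (Automorphism G) λ α → Σ (Automorphism H) λ β → ∀ v → to g v ≡ to (α ⊠ β) v

PreservesLayers : Automorphism (G □ H) → Set
PreservesLayers g = (∀ x x′ y → proj₂ (to g (x , y)) ≡ proj₂ (to g (x′ , y)))
                  × (∀ x y y′ → proj₁ (to g (x , y)) ≡ proj₁ (to g (x , y′)))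

module _ (irrG : Irreflexive _≡_ (Adj G)) (irrH : Irreflexive _≡_ (Adj H)) where

  □-adjˡ : ∀ {u v} → proj₂ u ≡ proj₂ v → Adj (G □ H) u v ⇔ Adj G (proj₁ u) (proj₁ v)
  □-adjˡ y≡y′ = mk⇔ (λ { (inj₁ (x∼x′ , _)) → x∼x′
                         ; (inj₂ (_ , y∼y′)) → ⊥-elim (irrH y≡y′ y∼y′) })
                    (λ x∼x′ → inj₁ (x∼x′ , y≡y′))

  □-adjʳ : ∀ {u v} → proj₁ u ≡ proj₁ v → Adj (G □ H) u v ⇔ Adj H (proj₂ u) (proj₂ v)
  □-adjʳ x≡x′ = mk⇔ (λ { (inj₁ (x∼x′ , _)) → ⊥-elim (irrG x≡x′ x∼x′)
                         ; (inj₂ (_ , y∼y′)) → y∼y′ })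
                    (λ y∼y′ → inj₂ (x≡x′ , y∼y′))

  splits : V G → V H → (∀ g → PreservesLayers g) → ∀ g → Splits g
  splits x₀ y₀ layers g = α , β , λ (x , y) → cong₂ _,_ (vertical x y y₀) (horizontal x x₀ y)
    where
    horizontal = proj₁ (layers g)
    vertical   = proj₂ (layers g)
    α : Automorphism G
    α = record
      { to = λ x → proj₁ (to g (x , y₀))
      ; from = λ x → proj₁ (from g (x , y₀))
      ; to-from = λ x → trans (vertical _ y₀ _) (cong proj₁ (to-from g (x , y₀)))
      ; from-to = λ x → trans (proj₂ (layers (g ⁻¹)) _ y₀ _) (cong proj₁ (from-to g (x , y₀)))
      ; adj = λ x x′ → □-adjˡ (horizontal x x′ y₀)
                   ⇔-∘ (adj g (x , y₀) (x′ , y₀) ⇔-∘ ⇔-sym (□-adjˡ refl))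
      }
    β : Automorphism H
    β = record
      { to = λ y → proj₂ (to g (x₀ , y))
      ; from = λ y → proj₂ (from g (x₀ , y))
      ; to-from = λ y → trans (horizontal x₀ _ _) (cong proj₂ (to-from g (x₀ , y)))
      ; from-to = λ y → trans (proj₁ (layers (g ⁻¹)) x₀ _ _) (cong proj₂ (from-to g (x₀ , y)))
      ; adj = λ y y′ → □-adjʳ (vertical x₀ y y′)
                   ⇔-∘ (adj g (x₀ , y) (x₀ , y′) ⇔-∘ ⇔-sym (□-adjʳ refl))
      }

module _ (x₀ : V G) (y₀ : V H) where

  pairUp : List (V G) → List (V H) → List (V G × V H)
  pairUp = alignWith (foldWithDefaults x₀ y₀ _,_)

  ∈-pairUpˡ : ∀ {x xs ys} → x ∈ xs → ∃ λ y → (x , y) ∈ pairUp xs ys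
  ∈-pairUpˡ {xs = _ ∷ _} {[]}    x∈xs         = y₀ , ∈-map⁺ _ x∈xs
  ∈-pairUpˡ {xs = _ ∷ _} {y ∷ _} (here refl)  = y , here refl
  ∈-pairUpˡ {xs = _ ∷ _} {_ ∷ _} (there x∈xs) = map₂ there (∈-pairUpˡ x∈xs)

  ∈-pairUpʳ : ∀ {y xs ys} → y ∈ ys → ∃ λ x → (x , y) ∈ pairUp xs ys
  ∈-pairUpʳ {xs = []}             y∈ys         = x₀ , ∈-map⁺ _ y∈ys
  ∈-pairUpʳ {xs = x ∷ _}  {_ ∷ _} (here refl)  = x , here refl
  ∈-pairUpʳ {xs = _ ∷ xs} {_ ∷ _} (there y∈ys) = map₂ there (∈-pairUpʳ {xs = xs} y∈ys)

  IsDetermining-pairUp : (∀ g → Splits g) → ∀ {S T} → IsDetermining G S → IsDetermining H T →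
                         IsDetermining (G □ H) (pairUp S T)
  IsDetermining-pairUp splits {S} {T} detS detT g fixes (x , y) with splits g
  ... | α , β , g≗α⊠β = trans (g≗α⊠β (x , y)) (cong₂ _,_ (detS α fixesS x) (detT β fixesT y))
    where
    fixesS : ∀ x → x ∈ S → to α x ≡ x
    fixesS x x∈S with ∈-pairUpˡ {ys = T} x∈S
    ... | y , xy∈ = cong proj₁ (trans (sym (g≗α⊠β (x , y))) (fixes _ xy∈))
    fixesT : ∀ y → y ∈ T → to β y ≡ y
    fixesT y y∈T with ∈-pairUpʳ {xs = S} y∈T
    ... | x , xy∈ = cong proj₂ (trans (sym (g≗α⊠β (x , y))) (fixes _ xy∈))

  IsDetermining-proj₁ : ∀ {S} → IsDetermining (G □ H) S → IsDetermining G (map proj₁ S)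
  IsDetermining-proj₁ detS α fixes x = cong proj₁ (detS (α ⊠ id-aut) fixesS (x , y₀))
    where fixesS = λ v v∈S → cong (_, proj₂ v) (fixes _ (∈-map⁺ proj₁ v∈S))

  IsDetermining-proj₂ : ∀ {S} → IsDetermining (G □ H) S → IsDetermining H (map proj₂ S)
  IsDetermining-proj₂ detS β fixes y = cong proj₂ (detS (id-aut ⊠ β) fixesS (x₀ , y))
    where fixesS = λ v v∈S → cong (proj₁ v ,_) (fixes _ (∈-map⁺ proj₂ v∈S))

Det-□ : ∀ {a b c} → DecidableEquality (V G) → DecidableEquality (V H) → V G → V H →
        (∀ g → Splits {G} {H} g) → Det (G □ H) a → Det G b → Det H c → a ≡ b ⊔ c
Det-□ {a = a} {b} {c} _≟G_ _≟H_ x₀ y₀ splits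
      detA@((U , _ , detU , |U|) , _) detB@((S , _ , detS , |S|) , _) detC@((T , _ , detT , |T|) , _) =
  ≤-antisym upper (⊔-lub lowerG lowerH)
  where
  upper : a ≤ b ⊔ c
  upper = subst (a ≤_) (trans (length-alignWith S T) (cong₂ _⊔_ |S| |T|))
            (det≤length (≡-dec-× _≟G_ _≟H_) detA (IsDetermining-pairUp x₀ y₀ splits detS detT))
  lowerG : b ≤ a
  lowerG = subst (b ≤_) (trans (length-map proj₁ U) |U|)
             (det≤length _≟G_ detB (IsDetermining-proj₁ x₀ y₀ detU))
  lowerH : c ≤ a
  lowerH = subst (c ≤_) (trans (length-map proj₂ U) |U|)
             (det≤length _≟H_ detC (IsDetermining-proj₂ x₀ y₀ detU))

toggle : Fin n → Vec Bool n → Vec Bool n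
toggle j x = x [ j ]%= not

antipode : Vec Bool n → Vec Bool n
antipode = Vec.map not

toggle-involutive : ∀ j (x : Vec Bool n) → toggle j (toggle j x) ≡ x
toggle-involutive j x =
  trans (updateAt-updateAt j x) (trans (updateAt-cong j not-involutive x) (updateAt-id j x))

antipode-involutive : (x : Vec Bool n) → antipode (antipode x) ≡ x
antipode-involutive x = trans (sym (map-∘ not not x)) (trans (map-cong not-involutive x) (map-id x))

toggle-comm : ∀ i j (x : Vec Bool n) → toggle i (toggle j x) ≡ toggle j (toggle i x)
toggle-comm i j x with i ≟ᶠ j
... | yes refl = refl
... | no i≢j   = updateAt-commutes i j i≢j x

toggle-antipode-comm : ∀ j (x : Vec Bool n) → toggle j (antipode x) ≡ antipode (toggle j x)
toggle-antipode-comm j x = sym (map-updateAt x j refl)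

differ-at : ∀ {u v : Vec Bool n} j → lookup u j ≡ not (lookup v j) → u ≢ v
differ-at j uj≡¬vj u≡v = not-¬ (cong (λ w → lookup w j) u≡v) uj≡¬vj

toggle-≢ : ∀ j (x : Vec Bool n) → toggle j x ≢ x
toggle-≢ j x = differ-at j (lookup∘updateAt j x)

toggle-injective : ∀ i j (x : Vec Bool n) → toggle i x ≡ toggle j x → i ≡ j
toggle-injective i j x eq with i ≟ᶠ j
... | yes i≡j = i≡j
... | no i≢j  =
  ⊥-elim (differ-at i (trans (lookup∘updateAt i x) (cong not (sym (lookup∘updateAt′ i j i≢j x)))) eq)

another : (j : Fin (2 + n)) → ∃ λ i → i ≢ j
another zero    = suc zero , λ ()
another (suc _) = zero , λ ()

antipode-≢-toggle : ∀ j (x : Vec Bool (2 + n)) → antipode x ≢ toggle j x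
antipode-≢-toggle j x with another j
... | i , i≢j = differ-at i (trans (lookup-map i not x) (cong not (sym (lookup∘updateAt′ i j i≢j x))))

differ-everywhere⇒antipode : (y y′ : Vec Bool n) → (∀ j → lookup y j ≢ lookup y′ j) → y′ ≡ antipode y
differ-everywhere⇒antipode []      []        _    = refl
differ-everywhere⇒antipode (b ∷ y) (b′ ∷ y′) diff =
  cong₂ _∷_ (¬-not (≢-sym (diff zero))) (differ-everywhere⇒antipode y y′ (diff ∘ suc))

antipode-differs : (y : Vec Bool n) → ∀ j → lookup y j ≢ lookup (antipode y) j
antipode-differs y j eq = not-¬ refl (trans eq (lookup-map j not y))

toggle-induction : (R : Vec Bool n → Set) → (∀ j x → R x → R (toggle j x)) →
                   ∀ {x₀} → R x₀ → ∀ x → R x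
toggle-induction R step {[]}     r []      = r
toggle-induction R step {b₀ ∷ _} r (b ∷ x) =
  fixHead (toggle-induction (R ∘ (b₀ ∷_)) (λ j x → step (suc j) (b₀ ∷ x)) r x)
  where
  fixHead : R (b₀ ∷ x) → R (b ∷ x)
  fixHead r with b ≟ᵇ b₀
  ... | yes refl = r
  ... | no b≢b₀  = subst (λ c → R (c ∷ x)) (sym (¬-not b≢b₀)) (step zero (b₀ ∷ x) r)

toggle-invariant⇒constant : ∀ {A : Set} (D : Vec Bool n → A) → (∀ j y → D (toggle j y) ≡ D y) →
                            ∀ y y′ → D y ≡ D y′
toggle-invariant⇒constant D invariant y y′ =
  toggle-induction (λ z → D z ≡ D y′) (λ j z eq → trans (invariant j z) eq) refl y

not-xor-not : ∀ a b → not a xor not b ≡ a xor b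
not-xor-not true  b = refl
not-xor-not false b = not-involutive b

hamming-refl : (x : Vec Bool n) → hamming x x ≡ 0
hamming-refl []          = refl
hamming-refl (true ∷ x)  = hamming-refl x
hamming-refl (false ∷ x) = hamming-refl x

hamming≡0⇒≡ : (x y : Vec Bool n) → hamming x y ≡ 0 → x ≡ y
hamming≡0⇒≡ []          []          _ = refl
hamming≡0⇒≡ (true ∷ x)  (true ∷ y)  h = cong (true ∷_) (hamming≡0⇒≡ x y h)
hamming≡0⇒≡ (false ∷ x) (false ∷ y) h = cong (false ∷_) (hamming≡0⇒≡ x y h)
hamming≡0⇒≡ (true ∷ x)  (false ∷ y) ()
hamming≡0⇒≡ (false ∷ x) (true ∷ y)  ()

hamming≤n : (x y : Vec Bool n) → hamming x y ≤ n
hamming≤n []          []          = z≤n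
hamming≤n (true ∷ x)  (true ∷ y)  = m≤n⇒m≤1+n (hamming≤n x y)
hamming≤n (false ∷ x) (false ∷ y) = m≤n⇒m≤1+n (hamming≤n x y)
hamming≤n (true ∷ x)  (false ∷ y) = s≤s (hamming≤n x y)
hamming≤n (false ∷ x) (true ∷ y)  = s≤s (hamming≤n x y)

hamming-toggle : (x : Vec Bool n) → ∀ j → hamming x (toggle j x) ≡ 1
hamming-toggle (true ∷ x)  zero    = cong suc (hamming-refl x)
hamming-toggle (false ∷ x) zero    = cong suc (hamming-refl x)
hamming-toggle (true ∷ x)  (suc j) = hamming-toggle x j
hamming-toggle (false ∷ x) (suc j) = hamming-toggle x j

hamming≡1⇒toggle : (x y : Vec Bool n) → hamming x y ≡ 1 → ∃ λ j → y ≡ toggle j x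
hamming≡1⇒toggle []          []          ()
hamming≡1⇒toggle (true ∷ x)  (true ∷ y)  h = Product.map suc (cong (true ∷_)) (hamming≡1⇒toggle x y h)
hamming≡1⇒toggle (false ∷ x) (false ∷ y) h = Product.map suc (cong (false ∷_)) (hamming≡1⇒toggle x y h)
hamming≡1⇒toggle (true ∷ x)  (false ∷ y) h = zero , cong (false ∷_) (sym (hamming≡0⇒≡ x y (cong pred h)))
hamming≡1⇒toggle (false ∷ x) (true ∷ y)  h = zero , cong (true ∷_) (sym (hamming≡0⇒≡ x y (cong pred h)))

hamming-antipode : (x : Vec Bool n) → hamming x (antipode x) ≡ n
hamming-antipode []          = refl
hamming-antipode (true ∷ x)  = cong suc (hamming-antipode x)
hamming-antipode (false ∷ x) = cong suc (hamming-antipode x)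

hamming≡n⇒antipode : (x y : Vec Bool n) → hamming x y ≡ n → y ≡ antipode x
hamming≡n⇒antipode []          []          _ = refl
hamming≡n⇒antipode (true ∷ x)  (true ∷ y)  h = ⊥-elim (1+n≰n (subst (_≤ _) h (hamming≤n x y)))
hamming≡n⇒antipode (false ∷ x) (false ∷ y) h = ⊥-elim (1+n≰n (subst (_≤ _) h (hamming≤n x y)))
hamming≡n⇒antipode (true ∷ x)  (false ∷ y) h = cong (false ∷_) (hamming≡n⇒antipode x y (cong pred h))
hamming≡n⇒antipode (false ∷ x) (true ∷ y)  h = cong (true ∷_) (hamming≡n⇒antipode x y (cong pred h))

hamming-++ : (x x′ : Vec Bool p) (y y′ : Vec Bool n) →
             hamming (x ++ y) (x′ ++ y′) ≡ hamming x x′ + hamming y y′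
hamming-++ []          []           y y′ = refl
hamming-++ (true ∷ x)  (true ∷ x′)  y y′ = hamming-++ x x′ y y′
hamming-++ (false ∷ x) (false ∷ x′) y y′ = hamming-++ x x′ y y′
hamming-++ (true ∷ x)  (false ∷ x′) y y′ = cong suc (hamming-++ x x′ y y′)
hamming-++ (false ∷ x) (true ∷ x′)  y y′ = cong suc (hamming-++ x x′ y y′)

data FQMove (n : ℕ) : Set where
  toggleAt  : Fin n → FQMove n
  antipodal : FQMove n

fqMove : FQMove n → Vec Bool n → Vec Bool n
fqMove (toggleAt j) = toggle j
fqMove antipodal    = antipode

fqMove-involutive : ∀ d (y : Vec Bool n) → fqMove d (fqMove d y) ≡ y
fqMove-involutive (toggleAt j) = toggle-involutive j
fqMove-involutive antipodal    = antipode-involutive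

fqMove-comm : ∀ d e (y : Vec Bool n) → fqMove d (fqMove e y) ≡ fqMove e (fqMove d y)
fqMove-comm (toggleAt i) (toggleAt j) y = toggle-comm i j y
fqMove-comm (toggleAt i) antipodal    y = toggle-antipode-comm i y
fqMove-comm antipodal    (toggleAt j) y = sym (toggle-antipode-comm j y)
fqMove-comm antipodal    antipodal    y = refl

fqMove-injective : ∀ d e (y : Vec Bool (2 + n)) → fqMove d y ≡ fqMove e y → d ≡ e
fqMove-injective (toggleAt i) (toggleAt j) y eq = cong toggleAt (toggle-injective i j y eq)
fqMove-injective (toggleAt i) antipodal    y eq = ⊥-elim (antipode-≢-toggle i y (sym eq))
fqMove-injective antipodal    (toggleAt j) y eq = ⊥-elim (antipode-≢-toggle j y eq)
fqMove-injective antipodal    antipodal    y eq = refl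

FQ-adj-fqMove : ∀ d (y : Vec Bool n) → Adj (FQ n) y (fqMove d y)
FQ-adj-fqMove (toggleAt j) y = inj₁ (hamming-toggle y j)
FQ-adj-fqMove antipodal    y = inj₂ (hamming-antipode y)

FQ-adj⇒fqMove : (y y′ : Vec Bool n) → Adj (FQ n) y y′ → ∃ λ d → y′ ≡ fqMove d y
FQ-adj⇒fqMove y y′ (inj₁ h) with hamming≡1⇒toggle y y′ h
... | j , y′≡ = toggleAt j , y′≡
FQ-adj⇒fqMove y y′ (inj₂ h) = antipodal , hamming≡n⇒antipode y y′ h

Q-irreflexive : Irreflexive _≡_ (Adj (Q n))
Q-irreflexive {x = x} refl h = 0≢1+n (trans (sym (hamming-refl x)) h)

FQ-irreflexive : Irreflexive _≡_ (Adj (FQ (suc n)))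
FQ-irreflexive {x = x} refl (inj₁ h) = 0≢1+n (trans (sym (hamming-refl x)) h)
FQ-irreflexive {x = x} refl (inj₂ h) = 0≢1+n (trans (sym (hamming-refl x)) h)

-- The enhanced hypercube as a product

m+n≡1-cases : ∀ m n → m + n ≡ 1 → (m ≡ 1 × n ≡ 0) ⊎ (m ≡ 0 × n ≡ 1)
m+n≡1-cases zero          n       m+n≡1 = inj₂ (refl , m+n≡1)
m+n≡1-cases (suc zero)    zero    _     = inj₁ (refl , refl)
m+n≡1-cases (suc zero)    (suc _) ()
m+n≡1-cases (suc (suc _)) _       ()

LongEdge : ∀ p {n} → Vec Bool (p + n) → Vec Bool (p + n) → Set
LongEdge p {n} v w = (j : Fin (p + n)) → (toℕ j < p → lookup v j ≡ lookup w j)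
                                       × (p ≤ toℕ j → lookup v j ≢ lookup w j)

LongEdge⇒ : (x x′ : Vec Bool p) (y y′ : Vec Bool n) →
            LongEdge p (x ++ y) (x′ ++ y′) → x ≡ x′ × y′ ≡ antipode y
LongEdge⇒ []      []        y y′ e = refl , differ-everywhere⇒antipode y y′ (λ j → proj₂ (e j) z≤n)
LongEdge⇒ (b ∷ x) (b′ ∷ x′) y y′ e =
  map₁ (cong₂ _∷_ (proj₁ (e zero) (s≤s z≤n))) (LongEdge⇒ x x′ y y′ e′)
  where
  e′ : LongEdge _ (x ++ y) (x′ ++ y′)
  e′ j = (λ j<p → proj₁ (e (suc j)) (s≤s j<p)) , (λ p≤j → proj₂ (e (suc j)) (s≤s p≤j))

LongEdge⇐ : (x : Vec Bool p) (y : Vec Bool n) → LongEdge p (x ++ y) (x ++ antipode y)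
LongEdge⇐ []      y j       = (λ ()) , (λ _ → antipode-differs y j)
LongEdge⇐ (b ∷ x) y zero    = (λ _ → refl) , (λ ())
LongEdge⇐ (b ∷ x) y (suc j) = (λ { (s≤s j<p) → proj₁ (LongEdge⇐ x y j) j<p })
                            , (λ { (s≤s p≤j) → proj₂ (LongEdge⇐ x y j) p≤j })

Q□FQ≅Qe : ∀ p n → Q p □ FQ n ≅ Qe (p + n) (suc p)
Q□FQ≅Qe p n = record
  { to = λ (x , y) → x ++ y
  ; from = λ v → take p v , drop p v
  ; to-from = take++drop≡id p
  ; from-to = λ (x , y) → Product.uncurry (cong₂ _,_)
                            (++-injective (take p (x ++ y)) x (take++drop≡id p (x ++ y)))
  ; adj = λ (x , y) (x′ , y′) → mk⇔ (edge⇒ x x′ y y′) (edge⇐ x x′ y y′)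
  }
  where
  edge⇒ : ∀ x x′ y y′ → Adj (Q p □ FQ n) (x , y) (x′ , y′) →
          Adj (Qe (p + n) (suc p)) (x ++ y) (x′ ++ y′)
  edge⇒ x x′ y .y (inj₁ (h , refl)) =
    inj₁ (trans (hamming-++ x x′ y y) (cong₂ _+_ h (hamming-refl y)))
  edge⇒ x .x y y′ (inj₂ (refl , inj₁ h)) =
    inj₁ (trans (hamming-++ x x y y′) (cong₂ _+_ (hamming-refl x) h))
  edge⇒ x .x y y′ (inj₂ (refl , inj₂ h)) rewrite hamming≡n⇒antipode y y′ h = inj₂ (LongEdge⇐ x y)
  edge⇐ : ∀ x x′ y y′ → Adj (Qe (p + n) (suc p)) (x ++ y) (x′ ++ y′) →
          Adj (Q p □ FQ n) (x , y) (x′ , y′)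
  edge⇐ x x′ y y′ (inj₁ h) with m+n≡1-cases _ _ (trans (sym (hamming-++ x x′ y y′)) h)
  ... | inj₁ (hx , hy) = inj₁ (hx , hamming≡0⇒≡ y y′ hy)
  ... | inj₂ (hx , hy) = inj₂ (hamming≡0⇒≡ x x′ hx , inj₁ hy)
  edge⇐ x x′ y y′ (inj₂ e) with LongEdge⇒ x x′ y y′ e
  ... | x≡x′ , refl = inj₂ (x≡x′ , inj₂ (hamming-antipode y))

-- Automorphisms of Q_p □ FQ_m

module Q□FQ (p m : ℕ) where

  Γ : Graph
  Γ = Q p □ FQ (2 + m)

  data Move : Set where
    horizontal : Fin p → Move
    vertical   : FQMove (2 + m) → Move

  move : Move → V Γ → V Γ
  move (horizontal i) (x , y) = toggle i x , y
  move (vertical d)   (x , y) = x , fqMove d y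

  move-adj : ∀ l w → Adj Γ w (move l w)
  move-adj (horizontal i) (x , y) = inj₁ (hamming-toggle x i , refl)
  move-adj (vertical d)   (x , y) = inj₂ (refl , FQ-adj-fqMove d y)

  adj⇒move : ∀ v w → Adj Γ v w → ∃ λ l → w ≡ move l v
  adj⇒move (x , y) (x′ , .y) (inj₁ (h , refl)) =
    Product.map horizontal (cong (_, y)) (hamming≡1⇒toggle x x′ h)
  adj⇒move (x , y) (.x , y′) (inj₂ (refl , h)) =
    Product.map vertical (cong (x ,_)) (FQ-adj⇒fqMove y y′ h)

  move-involutive : ∀ l w → move l (move l w) ≡ w
  move-involutive (horizontal i) (x , y) = cong (_, y) (toggle-involutive i x)
  move-involutive (vertical d)   (x , y) = cong (x ,_) (fqMove-involutive d y)

  move-comm : ∀ l l′ w → move l (move l′ w) ≡ move l′ (move l w)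
  move-comm (horizontal i) (horizontal j) (x , y) = cong (_, y) (toggle-comm i j x)
  move-comm (horizontal i) (vertical e)   w       = refl
  move-comm (vertical d)   (horizontal j) w       = refl
  move-comm (vertical d)   (vertical e)   (x , y) = cong (x ,_) (fqMove-comm d e y)

  move-injective : ∀ l l′ w → move l w ≡ move l′ w → l ≡ l′
  move-injective (horizontal i) (horizontal j) (x , y) eq =
    cong horizontal (toggle-injective i j x (cong proj₁ eq))
  move-injective (horizontal i) (vertical e)   (x , y) eq = ⊥-elim (toggle-≢ i x (cong proj₁ eq))
  move-injective (vertical d)   (horizontal j) (x , y) eq = ⊥-elim (toggle-≢ j x (sym (cong proj₁ eq)))
  move-injective (vertical d)   (vertical e)   (x , y) eq =
    cong vertical (fqMove-injective d e y (cong proj₂ eq))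

  move-induction : (R : V Γ → Set) → (∀ l w → R w → R (move l w)) → ∀ {w₀} → R w₀ → ∀ w → R w
  move-induction R step {x₀ , y₀} r (x , y) =
    toggle-induction (λ y → R (x , y)) (λ j y → step (vertical (toggleAt j)) (x , y))
      (toggle-induction (λ x → R (x , y₀)) (λ i x → step (horizontal i) (x , y₀)) r x) y

  Flips : (V Γ → Bool) → Move → V Γ → Set
  Flips C l w = C (move l w) ≡ not (C w)

  Matching : (V Γ → Bool) → Set
  Matching C = ∀ l l′ w → Flips C l w → Flips C l′ w → l ≡ l′

  flips-back : ∀ C l w → Flips C l w → Flips C l (move l w)
  flips-back C l w flips = begin
    C (move l (move l w))  ≡⟨ cong C (move-involutive l w) ⟩
    C w                    ≡⟨ sym (not-involutive (C w)) ⟩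
    not (not (C w))        ≡⟨ cong not (sym flips) ⟩
    not (C (move l w))     ∎
    where open ≡-Reasoning

  module _ {C : V Γ → Bool} (matching : Matching C) where

    stays : ∀ t l w → Flips C t w → l ≢ t → C (move l w) ≡ C w
    stays t l w flips l≢t with C (move l w) ≟ᵇ not (C w)
    ... | yes flipsˡ = ⊥-elim (l≢t (matching l t w flipsˡ flips))
    ... | no ¬flipsˡ = trans (¬-not ¬flipsˡ) (not-involutive (C w))

    -- In the square spanned by t and s ≢ t the two t-edges are opposite, and at each
    -- corner only the t-edge changes C.
    flips-everywhere : ∀ t w₀ → Flips C t w₀ → ∀ w → Flips C t w
    flips-everywhere t w₀ = move-induction (Flips C t) transport
      where
      transport : ∀ s w → Flips C t w → Flips C t (move s w)
      transport s w flips with C (move s w) ≟ᵇ not (C w)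
      ... | yes flipsˢ =
        subst (λ s → Flips C t (move s w)) (matching t s w flips flipsˢ) (flips-back C t w flips)
      ... | no ¬flipsˢ = begin
        C (move t (move s w))  ≡⟨ cong C (move-comm t s w) ⟩
        C (move s (move t w))  ≡⟨ stays t s (move t w) (flips-back C t w flips) s≢t ⟩
        C (move t w)           ≡⟨ flips ⟩
        not (C w)              ≡⟨ cong not (sym (stays t s w flips s≢t)) ⟩
        not (C (move s w))     ∎
        where
        open ≡-Reasoning
        s≢t : s ≢ t
        s≢t refl = ¬flipsˢ flips

    -- Toggling every coordinate of y₀ and then taking the antipodal edge back is a closed
    -- walk crossing the class of d once: D would be toggle-invariant, yet changed by antipode.
    no-vertical-flips : ∀ d w₀ → Flips C (vertical d) w₀ → ⊥
    no-vertical-flips antipodal (x₀ , y₀) flips =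
      not-¬ (toggle-invariant⇒constant D invariant (antipode y₀) y₀) flips
      where
      D : Vec Bool (2 + m) → Bool
      D y = C (x₀ , y)
      invariant : ∀ j y → D (toggle j y) ≡ D y
      invariant j y = stays (vertical antipodal) (vertical (toggleAt j)) (x₀ , y)
                        (flips-everywhere (vertical antipodal) (x₀ , y₀) flips (x₀ , y)) (λ ())
    no-vertical-flips (toggleAt j) (x₀ , y₀) flips =
      not-¬ (toggle-invariant⇒constant D invariant (antipode y₀) y₀) antipode-flips
      where
      t : Move
      t = vertical (toggleAt j)
      D : Vec Bool (2 + m) → Bool
      D y = C (x₀ , y) xor lookup y j
      flips-at : ∀ y → Flips C t (x₀ , y)
      flips-at y = flips-everywhere t (x₀ , y₀) flips (x₀ , y)
      invariant : ∀ l y → D (toggle l y) ≡ D y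
      invariant l y with l ≟ᶠ j
      ... | yes refl = trans (cong₂ _xor_ (flips-at y) (lookup∘updateAt l y))
                             (not-xor-not (C (x₀ , y)) (lookup y l))
      ... | no l≢j   = cong₂ _xor_ (stays t (vertical (toggleAt l)) (x₀ , y) (flips-at y) λ { refl → l≢j refl })
                                   (lookup∘updateAt′ j l (≢-sym l≢j) y)
      antipode-flips : D (antipode y₀) ≡ not (D y₀)
      antipode-flips = trans (cong₂ _xor_ (stays t (vertical antipodal) (x₀ , y₀) flips (λ ()))
                                          (lookup-map j not y₀))
                             (sym (not-distribʳ-xor (C (x₀ , y₀)) (lookup y₀ j)))

  image-move : (g : Automorphism Γ) → ∀ l w → ∃ λ r → to g (move l w) ≡ move r (to g w)
  image-move g l w = adj⇒move _ _ (⇔.to (adj g w (move l w)) (move-adj l w))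

  -- colour g i changes exactly along the edges that g sends to the i-th coordinate class of Q_p.
  colour : Automorphism Γ → Fin p → V Γ → Bool
  colour g i w = lookup (proj₁ (to g w)) i

  toggling-move : ∀ r v i → lookup (proj₁ (move r v)) i ≡ not (lookup (proj₁ v) i) → r ≡ horizontal i
  toggling-move (horizontal j) (x , y) i toggled with j ≟ᶠ i
  ... | yes j≡i = cong horizontal j≡i
  ... | no j≢i  = ⊥-elim (not-¬ (lookup∘updateAt′ i j (≢-sym j≢i) x) toggled)
  toggling-move (vertical d)   (x , y) i toggled = ⊥-elim (not-¬ refl toggled)

  colour-matching : (g : Automorphism Γ) → ∀ i → Matching (colour g i)
  colour-matching g i l l′ w flipsˡ flipsˡ′ with image-move g l w | image-move g l′ w
  ... | r , gl | r′ , gl′ = move-injective l l′ w (≅-to-injective (aut⇒≅ g) (begin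
    to g (move l w)   ≡⟨ gl ⟩
    move r (to g w)   ≡⟨ cong (λ s → move s (to g w)) (trans (horizontal-image gl flipsˡ)
                                                              (sym (horizontal-image gl′ flipsˡ′))) ⟩
    move r′ (to g w)  ≡⟨ sym gl′ ⟩
    to g (move l′ w)  ∎))
    where
    open ≡-Reasoning
    horizontal-image : ∀ {l r} → to g (move l w) ≡ move r (to g w) →
                       Flips (colour g i) l w → r ≡ horizontal i
    horizontal-image {r = r} gl flips =
      toggling-move r (to g w) i (trans (cong (λ v → lookup (proj₁ v) i) (sym gl)) flips)

  vertical↛horizontal : (g : Automorphism Γ) → ∀ d i w →
                        to g (move (vertical d) w) ≢ move (horizontal i) (to g w)
  vertical↛horizontal g d i w eq = no-vertical-flips (colour-matching g i) d w
    (trans (cong (λ v → lookup (proj₁ v) i) eq) (lookup∘updateAt i (proj₁ (to g w))))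

  horizontal↛vertical : (g : Automorphism Γ) → ∀ i d w →
                        to g (move (horizontal i) w) ≢ move (vertical d) (to g w)
  horizontal↛vertical g i d w eq = vertical↛horizontal (g ⁻¹) d i (to g w) (begin
    from g (move (vertical d) (to g w))    ≡⟨ cong (from g) (sym eq) ⟩
    from g (to g (move (horizontal i) w))  ≡⟨ from-to g _ ⟩
    move (horizontal i) w                  ≡⟨ cong (move (horizontal i)) (sym (from-to g w)) ⟩
    move (horizontal i) (from g (to g w))  ∎)
    where open ≡-Reasoning

  preserves-layers : (g : Automorphism Γ) → PreservesLayers g
  preserves-layers g = horizontal-layers , vertical-layers
    where
    horizontal-layers : ∀ x x′ y → proj₂ (to g (x , y)) ≡ proj₂ (to g (x′ , y))
    horizontal-layers x x′ y =
      toggle-induction (λ x → proj₂ (to g (x , y)) ≡ proj₂ (to g (x′ , y))) step refl x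
      where
      step : ∀ i x → proj₂ (to g (x , y)) ≡ proj₂ (to g (x′ , y)) →
             proj₂ (to g (toggle i x , y)) ≡ proj₂ (to g (x′ , y))
      step i x eq with image-move g (horizontal i) (x , y)
      ... | horizontal _ , g≡ = trans (cong proj₂ g≡) eq
      ... | vertical d   , g≡ = ⊥-elim (horizontal↛vertical g i d (x , y) g≡)
    vertical-layers : ∀ x y y′ → proj₁ (to g (x , y)) ≡ proj₁ (to g (x , y′))
    vertical-layers x y y′ =
      toggle-induction (λ y → proj₁ (to g (x , y)) ≡ proj₁ (to g (x , y′))) step refl y
      where
      step : ∀ j y → proj₁ (to g (x , y)) ≡ proj₁ (to g (x , y′)) →
             proj₁ (to g (x , toggle j y)) ≡ proj₁ (to g (x , y′))
      step j y eq with image-move g (vertical (toggleAt j)) (x , y)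
      ... | vertical _   , g≡ = trans (cong proj₁ g≡) eq
      ... | horizontal i , g≡ = ⊥-elim (vertical↛horizontal g (toggleAt j) i (x , y) g≡)

Det-Q□FQ : ∀ p m {a b c} → Det (Q p □ FQ (2 + m)) a → Det (Q p) b → Det (FQ (2 + m)) c →
           a ≡ b ⊔ c
Det-Q□FQ p m = Det-□ (≡-dec-Vec _≟ᵇ_) (≡-dec-Vec _≟ᵇ_) x₀ y₀
                     (splits Q-irreflexive FQ-irreflexive x₀ y₀ (Q□FQ.preserves-layers p m))
  where
  x₀ = Vec.replicate p false
  y₀ = Vec.replicate (2 + m) false

enhanced-dimensions : ∀ {n k} → 1 ≤ k → k ≤ n ∸ 1 →
                      Σ ℕ λ p → Σ ℕ λ m → k ≡ suc p × n ≡ p + (2 + m) × n ∸ k + 1 ≡ 2 + m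
enhanced-dimensions {zero}  {suc p} (s≤s z≤n) ()
enhanced-dimensions {suc n} {suc p} (s≤s z≤n) k≤n with m≤n⇒∃[o]m+o≡n k≤n
... | m , refl = p , m , refl , sym (trans (+-suc p (suc m)) (cong suc (+-suc p m))) , fibre-dimension
  where
  open ≡-Reasoning
  fibre-dimension : suc (p + m) ∸ p + 1 ≡ 2 + m
  fibre-dimension = begin
    suc (p + m) ∸ p + 1  ≡⟨ cong (_+ 1) (+-∸-assoc 1 (m≤m+n p m)) ⟩
    suc (p + m ∸ p) + 1  ≡⟨ cong (λ d → suc d + 1) (m+n∸m≡n p m) ⟩
    suc m + 1            ≡⟨ +-comm (suc m) 1 ⟩
    2 + m                ∎

-- The hypothesis 2 ≤ n follows from the other two.
proposition6p5 : (n k : ℕ) → 2 ≤ n → 1 ≤ k → k ≤ n ∸ 1 →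
    (a b c : ℕ) → Det (Qe n k) a → Det (Q (k ∸ 1)) b → Det (FQ (n ∸ k + 1)) c →
    a ≡ b ⊔ c
proposition6p5 n k _ 1≤k k≤n∸1 a b c detQe detQ detFQ with enhanced-dimensions {n} {k} 1≤k k≤n∸1
... | p , m , refl , refl , fibre-dimension =
  Det-Q□FQ p m (Det-resp-≅ (≅-sym (Q□FQ≅Qe p (2 + m))) detQe) detQ
    (subst (λ d → Det (FQ d) c) fibre-dimension detFQ)
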